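{- For every integer $n\ge 5$, $\mathrm{ex}(n,\mathcal F(5,2))\le \tfrac12\big(n^{5/2}+3n^2\big)$.
   Context: A simplicial complex is a pair $H=(V,E)$ with $E\subseteq\mathscr P(V)$ closed under taking subsets; all sets in $E$ (including the empty set and singletons) count as edges. For positive integers $k>d$, $\mathcal F(k,d)$ is the family of all simplicial complexes with vertex set $[k]$ and exactly $1+\sum_{i=0}^{d}\binom ki$ edges. $H$ contains a copy of $F$ if there is an injection $\varphi:V(F)\to V(H)$ with $\varphi(e)\in E(H)$ for every $e\in E(F)$. $\mathrm{ex}(n,\mathcal F)$ is the maximum number of edges of a simplicial complex on $n$ vertices containing no copy of any member of $\mathcal F$. -}

module Defs where

open import Data.Nat using (ℕ; zero; suc; _+_; _*_; _^_; _∸_; _≤_)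
open import Data.Bool using (Bool; true; false; if_then_else_)
open import Data.Fin using (Fin)
open import Data.Fin.Subset using (Subset; _⊆_; _∈_; ⁅_⁆; _∪_; ⊥; inside; outside)
open import Data.Vec using (Vec; []; _∷_; lookup)
open import Data.List using (List; []; _∷_; map; _++_; filter; length)
open import Data.Product using (Σ; _×_)
open import Function.Definitions using (Injective)
open import Relation.Binary.PropositionalEquality using (_≡_)
open import Relation.Nullary using (¬_)
import Data.Bool.Properties as BoolP

-- Every set in the family (including ∅ and singletons) counts as an edge.
record Complex (n : ℕ) : Set where
  field
    edge   : Subset n → Bool
    closed : ∀ (s t : Subset n) → s ⊆ t → edge t ≡ true → edge s ≡ true
open Complex public

allSubsets : (n : ℕ) → List (Subset n)
allSubsets zero    = [] ∷ []
allSubsets (suc n) = map (inside ∷_) (allSubsets n) ++ map (outside ∷_) (allSubsets n)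

numEdges : ∀ {n} → Complex n → ℕ
numEdges {n} H = length (filter (λ s → edge H s BoolP.≟ true) (allSubsets n))

image : ∀ {k n} → (Fin k → Fin n) → Subset k → Subset n
image {zero}  φ []             = ⊥
image {suc k} φ (inside  ∷ s)  = ⁅ φ Fin.zero ⁆ ∪ image (λ i → φ (Fin.suc i)) s
image {suc k} φ (outside ∷ s)  = image (λ i → φ (Fin.suc i)) s

ContainsCopy : ∀ {n k} → Complex n → Complex k → Set
ContainsCopy {n} {k} H F =
  Σ (Fin k → Fin n) λ φ → Injective _≡_ _≡_ φ ×
    (∀ (e : Subset k) → edge F e ≡ true → edge H (image φ e) ≡ true)

binomSum : ℕ → ℕ → ℕ
binomSum k zero    = 1
binomSum k (suc d) = binomSum k d + Data.Nat.Combinatorics._C_ k (suc d)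
  where import Data.Nat.Combinatorics

InFamily : (k d : ℕ) → Complex k → Set
InFamily k d F = numEdges F ≡ 1 + binomSum k d

FFree : ∀ {n} (k d : ℕ) → Complex n → Set
FFree k d H = ∀ (F : Complex k) → InFamily k d F → ¬ ContainsCopy H F

module Submission where

-- Put ε(H) = 2|E(H)| ∸ 3n² for a complex H on n vertices; we show ε(H)² ≤ n⁵ by induction on n.
-- The edges of H on m + 1 vertices are those of the deletion of a vertex and those of its link,
-- and 3(m + 1)² = 3m² + (6m + 3), so ε(H) ≤ r + δ with r the excess of the deletion and
-- δ = 2|E(link)| ∸ (6m + 3).  If δ² ≤ 4m³ then rδ ≤ 2m⁴ and (r + δ)² ≤ m⁵ + 4m⁴ + 4m³ ≤ (m + 1)⁵.
-- Two members of 𝓕(5,2) bound the link.  A tetrahedron plus a disjoint vertex forces every link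
-- face to lie inside any link face of size three, so either the link has at most 8 faces or it is
-- a graph (with loops).  A fan of three triangles at an apex whose rim is closed by an edge makes
-- that graph C4-free, so any two distinct vertices have codegree at most 3, and Cauchy–Schwarz on
-- the degrees bounds the degree sum S by S² ≤ mS + 3m³; this gives δ² ≤ 4m³.

open import Defs
open import Data.Nat using (ℕ; zero; suc; _+_; _*_; _^_; _∸_; _≤_; _<_; z≤n; s≤s; _≤?_)
open import Data.Nat.Properties
  using ( +-*-semiring; +-comm; +-identityʳ; +-mono-≤; +-monoʳ-≤; +-monoˡ-≤; +-cancelʳ-≤
        ; *-comm; *-distribˡ-+; *-identityˡ; *-zeroʳ; *-mono-≤; *-monoʳ-≤; *-monoˡ-≤; *-cancelˡ-≤
        ; ^-monoˡ-≤; ^-monoʳ-≤; ^-monoˡ-<; ∸-monoˡ-≤; m+[n∸m]≡n; m+n∸m≡n; m≤n+m∸n; m≤n⇒m∸n≡0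
        ; ≤-refl; ≤-reflexive; ≤-trans; ≤-total; ≤-pred; m≤m+n; n≤1+n; <⇒≤; <⇒≱; ≮⇒≥; ≰⇒>
        ; module ≤-Reasoning )
open import Data.Nat.Tactic.RingSolver using (solve-∀)
open import Data.Nat.Solver using (module +-*-Solver)
open import Algebra.Properties.Semiring.Sum +-*-semiring
  using (sum; sum-syntax; sum-cong-≗; ∑-distrib-+; ∑-comm; *-distribˡ-sum; *-distribʳ-sum)
open import Data.Bool using (Bool; true; false; _∧_)
open import Data.Bool.Properties using (¬-not; ∧-idem) renaming (_≟_ to _≟ᵇ_)
open import Data.Fin using (Fin; zero; suc)
open import Data.Fin.Properties using (_≟_; 0≢1+n; suc-injective)
open import Data.Fin.Subset using (Subset; _⊆_; _∈_; ⁅_⁆; _∪_; ⊥; ⊤; inside; outside; ∣_∣)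
open import Data.Fin.Subset.Properties
  using ( _⊆?_; _∈?_; anySubset?; s⊆s; ⊆-trans; ⊆⊤; drop-∷-⊆; ∉⊥; x∈⁅x⁆; x∈⁅y⁆⇒x≡y; x∈p∪q⁺; x∈p∪q⁻
        ; ∪-comm; ∪-identityˡ; ∪-identityʳ; ∣⊤∣≡n )
open import Data.Vec as Vec using (Vec; []; _∷_; here; there; lookup)
open import Data.Vec.Relation.Unary.All as VecAll using ([]; _∷_)
import Data.Vec.Relation.Unary.All.Properties as VecAll
open import Data.Vec.Relation.Unary.AllPairs using ([]; _∷_)
open import Data.Vec.Relation.Unary.Unique.Propositional using (Unique)
import Data.Vec.Relation.Unary.Unique.Propositional.Properties as Unique
open import Data.List using (List; []; _∷_; map; _++_; filter; length)
open import Data.List.Properties using (filter-++; length-++)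
open import Data.List.Relation.Unary.All using (All; []; _∷_)
open import Data.List.Relation.Unary.Any as Any using (any?)
open import Data.Product using (∃; _×_; _,_)
open import Data.Sum using (_⊎_; inj₁; inj₂; [_,_]′)
open import Function using (_∘_)
open import Relation.Binary.PropositionalEquality
open import Relation.Nullary using (Dec; yes; no; does; ¬_; ¬?; _×-dec_; contradiction)
open import Relation.Nullary.Decidable using (dec-true; dec-false; from-yes)

-- Counting families of subsets

𝟙 : Bool → ℕ
𝟙 true  = 1
𝟙 false = 0

𝟙≤1 : ∀ b → 𝟙 b ≤ 1
𝟙≤1 true  = s≤s z≤n
𝟙≤1 false = z≤n

count : ∀ {n} → (Subset n → Bool) → ℕ
count {zero}  P = 𝟙 (P [])
count {suc n} P = count (P ∘ (inside ∷_)) + count (P ∘ (outside ∷_))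

length-filter-map : ∀ {A B : Set} (P : B → Bool) (f : A → B) (xs : List A) →
  length (filter (λ y → P y ≟ᵇ true) (map f xs)) ≡ length (filter (λ x → P (f x) ≟ᵇ true) xs)
length-filter-map P f []       = refl
length-filter-map P f (x ∷ xs) with P (f x)
... | true  = cong suc (length-filter-map P f xs)
... | false = length-filter-map P f xs

length-filter-allSubsets : ∀ {n} (P : Subset n → Bool) →
  length (filter (λ s → P s ≟ᵇ true) (allSubsets n)) ≡ count P
length-filter-allSubsets {zero} P with P []
... | true  = refl
... | false = refl
length-filter-allSubsets {suc n} P = begin
  length (filter P? (insides ++ outsides))                  ≡⟨ cong length (filter-++ P? insides outsides) ⟩
  length (filter P? insides ++ filter P? outsides)          ≡⟨ length-++ (filter P? insides) ⟩
  length (filter P? insides) + length (filter P? outsides)  ≡⟨ cong₂ _+_ (counted inside) (counted outside) ⟩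
  count P                                                   ∎
  where
  open ≡-Reasoning
  P? = λ s → P s ≟ᵇ true
  insides  = map (inside ∷_) (allSubsets n)
  outsides = map (outside ∷_) (allSubsets n)
  counted : ∀ b → length (filter P? (map (b ∷_) (allSubsets n))) ≡ count (P ∘ (b ∷_))
  counted b = trans (length-filter-map P (b ∷_) (allSubsets n)) (length-filter-allSubsets (P ∘ (b ∷_)))

numEdges≡count : ∀ {n} (H : Complex n) → numEdges H ≡ count (edge H)
numEdges≡count H = length-filter-allSubsets (edge H)

count-empty : ∀ {n} (P : Subset n → Bool) → (∀ s → ¬ P s ≡ true) → count P ≡ 0
count-empty {zero}  P none = cong 𝟙 (¬-not (none []))
count-empty {suc n} P none = cong₂ _+_ (count-empty _ (none ∘ (inside ∷_))) (count-empty _ (none ∘ (outside ∷_)))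

count≤2^∣X∣ : ∀ {n} (P : Subset n → Bool) (X : Subset n) → (∀ s → P s ≡ true → s ⊆ X) →
  count P ≤ 2 ^ ∣ X ∣
count≤2^∣X∣ P []            _  = 𝟙≤1 (P [])
count≤2^∣X∣ P (inside ∷ X)  ⊆X rewrite +-identityʳ (2 ^ ∣ X ∣) =
  +-mono-≤ (count≤2^∣X∣ _ X (λ s e → drop-∷-⊆ (⊆X _ e))) (count≤2^∣X∣ _ X (λ s e → drop-∷-⊆ (⊆X _ e)))
count≤2^∣X∣ P (outside ∷ X) ⊆X = begin
  count (P ∘ (inside ∷_)) + count (P ∘ (outside ∷_))  ≡⟨ cong (_+ count (P ∘ (outside ∷_))) (count-empty _ (λ s → zero∉ ∘ ⊆X (inside ∷ s))) ⟩
  count (P ∘ (outside ∷_))                            ≤⟨ count≤2^∣X∣ _ X (λ s e → drop-∷-⊆ (⊆X _ e)) ⟩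
  2 ^ ∣ X ∣                                            ∎
  where
  open ≤-Reasoning
  zero∉ : ∀ {t} → ¬ (inside ∷ t ⊆ outside ∷ X)
  zero∉ t⊆ with t⊆ here
  ... | ()

count≤2^n : ∀ {n} (P : Subset n → Bool) → count P ≤ 2 ^ n
count≤2^n {n} P = subst (λ k → count P ≤ 2 ^ k) (∣⊤∣≡n n) (count≤2^∣X∣ P ⊤ (λ _ _ → ⊆⊤))

-- Finite sums and Cauchy–Schwarz

∑-mono-≤ : ∀ {n} {f g : Fin n → ℕ} → (∀ i → f i ≤ g i) → sum f ≤ sum g
∑-mono-≤ {zero}  f≤g = z≤n
∑-mono-≤ {suc n} f≤g = +-mono-≤ (f≤g zero) (∑-mono-≤ (f≤g ∘ suc))

∑-const : ∀ n c → ∑[ i < n ] c ≡ n * c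
∑-const zero    c = refl
∑-const (suc n) c = cong (c +_) (∑-const n c)

∑𝟙≤1 : ∀ {n} {Q : Fin n → Set} (Q? : ∀ a → Dec (Q a)) → (∀ {a a′} → Q a → Q a′ → a ≡ a′) →
  ∑[ a < n ] 𝟙 (does (Q? a)) ≤ 1
∑𝟙≤1 {zero}  Q? unique = z≤n
∑𝟙≤1 {suc n} Q? unique with Q? zero
... | yes q = s≤s (begin
  ∑[ a < n ] 𝟙 (does (Q? (suc a)))  ≡⟨ sum-cong-≗ (λ a → cong 𝟙 (dec-false (Q? (suc a)) (0≢1+n ∘ unique q))) ⟩
  ∑[ a < n ] 0                      ≡⟨ ∑-const n 0 ⟩
  n * 0                             ≡⟨ *-zeroʳ n ⟩
  0                                 ∎)
  where open ≤-Reasoning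
... | no _ = ∑𝟙≤1 (Q? ∘ suc) (λ q q′ → suc-injective (unique q q′))

∑δ≤1 : ∀ {n} (b : Fin n) → ∑[ a < n ] 𝟙 (does (a ≟ b)) ≤ 1
∑δ≤1 b = ∑𝟙≤1 (_≟ b) (λ a≡b a′≡b → trans a≡b (sym a′≡b))

2xy≤x²+y² : ∀ x y → 2 * (x * y) ≤ x * x + y * y
2xy≤x²+y² x y = [ ordered , (λ y≤x → subst₂ _≤_ (cong (2 *_) (*-comm y x)) (+-comm (y * y) (x * x)) (ordered y≤x)) ]′ (≤-total x y)
  where
  -- with y = x + k the two sides differ by k²
  ordered : ∀ {x y} → x ≤ y → 2 * (x * y) ≤ x * x + y * y
  ordered {x} {y} x≤y = subst (λ y → 2 * (x * y) ≤ x * x + y * y) (m+[n∸m]≡n x≤y)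
    (≤-trans (m≤m+n _ ((y ∸ x) * (y ∸ x))) (≤-reflexive (expand x (y ∸ x))))
    where
    expand : ∀ x k → 2 * (x * (x + k)) + k * k ≡ x * x + (x + k) * (x + k)
    expand = solve-∀

∑²≡∑∑ : ∀ {n} (d : Fin n → ℕ) → sum d * sum d ≡ ∑[ i < n ] ∑[ j < n ] (d i * d j)
∑²≡∑∑ d = trans (*-distribʳ-sum (sum d) d) (sum-cong-≗ λ i → *-distribˡ-sum (d i) d)

cauchy-schwarz : ∀ {n} (d : Fin n → ℕ) → sum d * sum d ≤ n * ∑[ i < n ] (d i * d i)
cauchy-schwarz {n} d = *-cancelˡ-≤ 2 (begin
  2 * (sum d * sum d)                            ≡⟨ cong (2 *_) (∑²≡∑∑ d) ⟩
  2 * ∑[ i < n ] ∑[ j < n ] (d i * d j)          ≡⟨ *-distribˡ-sum 2 (λ i → ∑[ j < n ] (d i * d j)) ⟩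
  ∑[ i < n ] (2 * ∑[ j < n ] (d i * d j))        ≡⟨ sum-cong-≗ (λ i → *-distribˡ-sum 2 (λ j → d i * d j)) ⟩
  ∑[ i < n ] ∑[ j < n ] (2 * (d i * d j))        ≤⟨ ∑-mono-≤ (λ i → ∑-mono-≤ (λ j → 2xy≤x²+y² (d i) (d j))) ⟩
  ∑[ i < n ] ∑[ j < n ] (d i * d i + d j * d j)  ≡⟨ sum-cong-≗ (λ i → trans (∑-distrib-+ (λ _ → d i * d i) (λ j → d j * d j))
                                                                         (cong (_+ Q) (∑-const n (d i * d i)))) ⟩
  ∑[ i < n ] (n * (d i * d i) + Q)               ≡⟨ trans (∑-distrib-+ (λ i → n * (d i * d i)) (λ _ → Q))
                                                          (cong₂ _+_ (sym (*-distribˡ-sum n (λ i → d i * d i))) (∑-const n Q)) ⟩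
  n * Q + n * Q                                  ≡⟨ cong (n * Q +_) (sym (+-identityʳ (n * Q))) ⟩
  2 * (n * Q)                                    ∎)
  where
  open ≤-Reasoning
  Q = ∑[ i < n ] (d i * d i)

-- Graphs with loops as families of sets of size at most two

SizesBelow : ∀ {n} → ℕ → (Subset n → Bool) → Set
SizesBelow k P = ∀ s → P s ≡ true → ∣ s ∣ < k

vertexCount : ∀ {n} → (Subset n → Bool) → ℕ
vertexCount {n} P = ∑[ a < n ] 𝟙 (P ⁅ a ⁆)

adjacency : ∀ {n} → (Subset n → Bool) → Fin n → Fin n → ℕ
adjacency P a b = 𝟙 (P (⁅ a ⁆ ∪ ⁅ b ⁆))

-- A singleton {a} in the family counts as a loop at a.
degree : ∀ {n} → (Subset n → Bool) → Fin n → ℕ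
degree {n} P a = ∑[ b < n ] adjacency P a b

degreeSum : ∀ {n} → (Subset n → Bool) → ℕ
degreeSum {n} P = ∑[ a < n ] degree P a

count-sizes<1 : ∀ {n} (P : Subset n → Bool) → SizesBelow 1 P → count P ≤ 𝟙 (P ⊥)
count-sizes<1 {zero}  P _     = ≤-refl
count-sizes<1 {suc n} P small rewrite count-empty (P ∘ (inside ∷_)) (λ s e → <⇒≱ (small (inside ∷ s) e) (s≤s z≤n)) =
  count-sizes<1 (P ∘ (outside ∷_)) (small ∘ (outside ∷_))

count-sizes<2 : ∀ {n} (P : Subset n → Bool) → SizesBelow 2 P → count P ≤ 𝟙 (P ⊥) + vertexCount P
count-sizes<2 {zero}  P _     = ≤-reflexive (sym (+-identityʳ _))
count-sizes<2 {suc n} P small = begin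
  count (P ∘ (inside ∷_)) + count (P ∘ (outside ∷_))
    ≤⟨ +-mono-≤ (count-sizes<1 _ (λ s e → ≤-pred (small (inside ∷ s) e))) (count-sizes<2 _ (small ∘ (outside ∷_))) ⟩
  𝟙 (P ⁅ zero ⁆) + (𝟙 (P ⊥) + vertexCount (P ∘ (outside ∷_)))
    ≡⟨ x+[y+z]≡y+[x+z] (𝟙 (P ⁅ zero ⁆)) (𝟙 (P ⊥)) _ ⟩
  𝟙 (P ⊥) + vertexCount P
    ∎
  where
  open ≤-Reasoning
  x+[y+z]≡y+[x+z] : ∀ x y z → x + (y + z) ≡ y + (x + z)
  x+[y+z]≡y+[x+z] = solve-∀

degreeSum-suc : ∀ {n} (P : Subset (suc n) → Bool) →
  degreeSum P ≡ (𝟙 (P ⁅ zero ⁆) + vertexCount (P ∘ (inside ∷_))) + (vertexCount (P ∘ (inside ∷_)) + degreeSum (P ∘ (outside ∷_)))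
degreeSum-suc P = cong₂ _+_
  (cong₂ _+_ (via-apex (∪-identityˡ ⊥)) (sum-cong-≗ λ b → via-apex (∪-identityˡ ⁅ b ⁆)))
  (trans (∑-distrib-+ (λ a → 𝟙 (P (inside ∷ (⁅ a ⁆ ∪ ⊥)))) (degree (P ∘ (outside ∷_))))
         (cong (_+ degreeSum (P ∘ (outside ∷_))) (sum-cong-≗ λ a → via-apex (∪-identityʳ ⁅ a ⁆))))
  where
  via-apex : ∀ {s t} → s ≡ t → 𝟙 (P (inside ∷ s)) ≡ 𝟙 (P (inside ∷ t))
  via-apex = cong (𝟙 ∘ P ∘ (inside ∷_))

count-sizes<3 : ∀ {n} (P : Subset n → Bool) → SizesBelow 3 P → 2 * count P ≤ 2 + n + degreeSum P
count-sizes<3 {zero}  P _     = *-monoʳ-≤ 2 (𝟙≤1 (P []))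
count-sizes<3 {suc n} P small rewrite degreeSum-suc P = begin
  2 * (c₀ + c₁)                      ≡⟨ *-distribˡ-+ 2 c₀ c₁ ⟩
  2 * c₀ + 2 * c₁                    ≤⟨ +-mono-≤ (*-monoʳ-≤ 2 c₀≤) c₁≤ ⟩
  2 * (x + v) + (2 + n + S)          ≡⟨ rearrange x v n S ⟩
  x + (2 + n + ((x + v) + (v + S)))  ≤⟨ +-monoˡ-≤ _ (𝟙≤1 x′) ⟩
  2 + suc n + ((x + v) + (v + S))    ∎
  where
  open ≤-Reasoning
  c₀ = count (P ∘ (inside ∷_))
  c₁ = count (P ∘ (outside ∷_))
  x′ = P ⁅ zero ⁆
  x = 𝟙 x′
  v = vertexCount (P ∘ (inside ∷_))
  S = degreeSum (P ∘ (outside ∷_))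
  c₀≤ : c₀ ≤ x + v
  c₀≤ = count-sizes<2 _ (λ s e → ≤-pred (small (inside ∷ s) e))
  c₁≤ : 2 * c₁ ≤ 2 + n + S
  c₁≤ = count-sizes<3 _ (small ∘ (outside ∷_))
  rearrange : ∀ x v n S → 2 * (x + v) + (2 + n + S) ≡ x + (2 + n + ((x + v) + (v + S)))
  rearrange = solve-∀

C4Free : ∀ {n} → (Subset n → Bool) → Set
C4Free {n} P = ∀ {p q r s : Fin n} → Unique (p ∷ q ∷ r ∷ s ∷ []) →
  P (⁅ p ⁆ ∪ ⁅ q ⁆) ≡ true → P (⁅ q ⁆ ∪ ⁅ r ⁆) ≡ true → P (⁅ r ⁆ ∪ ⁅ s ⁆) ≡ true → ¬ P (⁅ s ⁆ ∪ ⁅ p ⁆) ≡ true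

codegree : ∀ {n} → (Subset n → Bool) → Fin n → Fin n → ℕ
codegree {n} P b c = ∑[ a < n ] (adjacency P a b * adjacency P a c)

𝟙*𝟙≡𝟙∧ : ∀ u v → 𝟙 u * 𝟙 v ≡ 𝟙 (u ∧ v)
𝟙*𝟙≡𝟙∧ true  v = +-identityʳ (𝟙 v)
𝟙*𝟙≡𝟙∧ false v = refl

𝟙*𝟙≤1 : ∀ u v → 𝟙 u * 𝟙 v ≤ 1
𝟙*𝟙≤1 u v = ≤-trans (≤-reflexive (𝟙*𝟙≡𝟙∧ u v)) (𝟙≤1 (u ∧ v))

adjacency-sym : ∀ {n} (P : Subset n → Bool) a b → adjacency P a b ≡ adjacency P b a
adjacency-sym P a b = cong (𝟙 ∘ P) (∪-comm ⁅ a ⁆ ⁅ b ⁆)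

codegree-diag : ∀ {n} (P : Subset n → Bool) b → codegree P b b ≡ degree P b
codegree-diag P b = sum-cong-≗ λ a → begin
  adjacency P a b * adjacency P a b          ≡⟨ 𝟙*𝟙≡𝟙∧ (P (⁅ a ⁆ ∪ ⁅ b ⁆)) (P (⁅ a ⁆ ∪ ⁅ b ⁆)) ⟩
  𝟙 (P (⁅ a ⁆ ∪ ⁅ b ⁆) ∧ P (⁅ a ⁆ ∪ ⁅ b ⁆))  ≡⟨ cong 𝟙 (∧-idem _) ⟩
  adjacency P a b                            ≡⟨ adjacency-sym P a b ⟩
  adjacency P b a                            ∎
  where open ≡-Reasoning

∑degree²≡∑∑codegree : ∀ {n} (P : Subset n → Bool) →
  ∑[ a < n ] (degree P a * degree P a) ≡ ∑[ b < n ] ∑[ c < n ] codegree P b c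
∑degree²≡∑∑codegree {n} P = begin
  ∑[ a < n ] (degree P a * degree P a)             ≡⟨ sum-cong-≗ (λ a → ∑²≡∑∑ (A a)) ⟩
  ∑[ a < n ] ∑[ b < n ] ∑[ c < n ] (A a b * A a c)  ≡⟨ ∑-comm (λ a b → ∑[ c < n ] (A a b * A a c)) ⟩
  ∑[ b < n ] ∑[ a < n ] ∑[ c < n ] (A a b * A a c)  ≡⟨ sum-cong-≗ (λ b → ∑-comm (λ a c → A a b * A a c)) ⟩
  ∑[ b < n ] ∑[ c < n ] codegree P b c             ∎
  where
  open ≡-Reasoning
  A = adjacency P

module _ {n} (P : Subset n → Bool) (c4Free : C4Free P) where

  codegree≤3 : ∀ {b c} → b ≢ c → codegree P b c ≤ 3
  codegree≤3 {b} {c} b≢c = begin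
    ∑[ a < n ] (adjacency P a b * adjacency P a c)                     ≤⟨ ∑-mono-≤ term≤ ⟩
    ∑[ a < n ] (δ b a + δ c a + 𝟙 (does (Q? a)))                     ≡⟨ trans (∑-distrib-+ (λ a → δ b a + δ c a) (𝟙 ∘ does ∘ Q?))
                                                                               (cong (_+ ∑[ a < n ] 𝟙 (does (Q? a))) (∑-distrib-+ (δ b) (δ c))) ⟩
    ∑[ a < n ] δ b a + ∑[ a < n ] δ c a + ∑[ a < n ] 𝟙 (does (Q? a))  ≤⟨ +-mono-≤ (+-mono-≤ (∑δ≤1 b) (∑δ≤1 c)) (∑𝟙≤1 Q? Q-unique) ⟩
    3                                                                 ∎
    where
    open ≤-Reasoning
    δ : Fin n → Fin n → ℕ
    δ b a = 𝟙 (does (a ≟ b))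
    Q : Fin n → Set
    Q a = a ≢ b × a ≢ c × P (⁅ a ⁆ ∪ ⁅ b ⁆) ≡ true × P (⁅ a ⁆ ∪ ⁅ c ⁆) ≡ true
    Q? : ∀ a → Dec (Q a)
    Q? a = ¬? (a ≟ b) ×-dec ¬? (a ≟ c) ×-dec (P (⁅ a ⁆ ∪ ⁅ b ⁆) ≟ᵇ true) ×-dec (P (⁅ a ⁆ ∪ ⁅ c ⁆) ≟ᵇ true)
    Q-unique : ∀ {a a′} → Q a → Q a′ → a ≡ a′
    Q-unique {a} {a′} (a≢b , a≢c , ab , ac) (a′≢b , a′≢c , a′b , a′c) with a ≟ a′
    ... | yes a≡a′ = a≡a′
    ... | no a≢a′  = contradiction a′b (c4Free distinct (trans (cong P (∪-comm ⁅ b ⁆ ⁅ a ⁆)) ab) ac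
                                                         (trans (cong P (∪-comm ⁅ c ⁆ ⁅ a′ ⁆)) a′c))
      where
      distinct : Unique (b ∷ a ∷ c ∷ a′ ∷ [])
      distinct = (≢-sym a≢b ∷ b≢c ∷ ≢-sym a′≢b ∷ []) ∷ (a≢c ∷ a≢a′ ∷ []) ∷ (≢-sym a′≢c ∷ []) ∷ [] ∷ []
    term≤ : ∀ a → 𝟙 (P (⁅ a ⁆ ∪ ⁅ b ⁆)) * 𝟙 (P (⁅ a ⁆ ∪ ⁅ c ⁆)) ≤ δ b a + δ c a + 𝟙 (does (Q? a))
    term≤ a with a ≟ b | a ≟ c
    ... | yes _ | _     = ≤-trans (𝟙*𝟙≤1 (P (⁅ a ⁆ ∪ ⁅ b ⁆)) (P (⁅ a ⁆ ∪ ⁅ c ⁆))) (s≤s z≤n)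
    ... | no _  | yes _ = ≤-trans (𝟙*𝟙≤1 (P (⁅ a ⁆ ∪ ⁅ b ⁆)) (P (⁅ a ⁆ ∪ ⁅ c ⁆))) (s≤s z≤n)
    ... | no _  | no _  with P (⁅ a ⁆ ∪ ⁅ b ⁆) | P (⁅ a ⁆ ∪ ⁅ c ⁆)
    ...   | true  | true  = ≤-refl
    ...   | true  | false = z≤n
    ...   | false | _     = z≤n

  codegree≤ : ∀ b c → codegree P b c ≤ 𝟙 (does (c ≟ b)) * degree P b + 3
  codegree≤ b c with c ≟ b
  ... | yes refl = ≤-trans (≤-reflexive (trans (codegree-diag P b) (sym (+-identityʳ (degree P b))))) (m≤m+n _ 3)
  ... | no c≢b   = codegree≤3 (≢-sym c≢b)

  ∑codegree≤ : ∀ b → ∑[ c < n ] codegree P b c ≤ degree P b + n * 3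
  ∑codegree≤ b = begin
    ∑[ c < n ] codegree P b c                          ≤⟨ ∑-mono-≤ (codegree≤ b) ⟩
    ∑[ c < n ] (𝟙 (does (c ≟ b)) * degree P b + 3)     ≡⟨ trans (∑-distrib-+ (λ c → 𝟙 (does (c ≟ b)) * degree P b) (λ _ → 3))
                                                                (cong₂ _+_ (sym (*-distribʳ-sum (degree P b) (λ c → 𝟙 (does (c ≟ b)))))
                                                                           (∑-const n 3)) ⟩
    ∑[ c < n ] 𝟙 (does (c ≟ b)) * degree P b + n * 3   ≤⟨ +-monoˡ-≤ (n * 3) (*-monoˡ-≤ (degree P b) (∑δ≤1 b)) ⟩
    1 * degree P b + n * 3                             ≡⟨ cong (_+ n * 3) (*-identityˡ (degree P b)) ⟩
    degree P b + n * 3                                 ∎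
    where open ≤-Reasoning

  degreeSum²≤ : degreeSum P * degreeSum P ≤ n * degreeSum P + 3 * (n * (n * n))
  degreeSum²≤ = begin
    degreeSum P * degreeSum P                 ≤⟨ cauchy-schwarz (degree P) ⟩
    n * ∑[ a < n ] (degree P a * degree P a)  ≡⟨ cong (n *_) (∑degree²≡∑∑codegree P) ⟩
    n * ∑[ b < n ] ∑[ c < n ] codegree P b c  ≤⟨ *-monoʳ-≤ n (∑-mono-≤ ∑codegree≤) ⟩
    n * ∑[ b < n ] (degree P b + n * 3)       ≡⟨ cong (n *_) (trans (∑-distrib-+ (degree P) (λ _ → n * 3))
                                                                    (cong (degreeSum P +_) (∑-const n (n * 3)))) ⟩
    n * (degreeSum P + n * (n * 3))           ≡⟨ expand n (degreeSum P) ⟩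
    n * degreeSum P + 3 * (n * (n * n))       ∎
    where
    open ≤-Reasoning
    expand : ∀ n S → n * (S + n * (n * 3)) ≡ n * S + 3 * (n * (n * n))
    expand = solve-∀

-- Arithmetic of the excess

m^2≤n^2⇒m≤n : ∀ {m n} → m ^ 2 ≤ n ^ 2 → m ≤ n
m^2≤n^2⇒m≤n m²≤n² = ≮⇒≥ (λ n<m → <⇒≱ (^-monoˡ-< 2 n<m) m²≤n²)

[x+y]∸[a+b]≤[x∸a]+[y∸b] : ∀ x y a b → (x + y) ∸ (a + b) ≤ (x ∸ a) + (y ∸ b)
[x+y]∸[a+b]≤[x∸a]+[y∸b] x y a b = begin
  (x + y) ∸ (a + b)                          ≤⟨ ∸-monoˡ-≤ (a + b) (+-mono-≤ (m≤n+m∸n x a) (m≤n+m∸n y b)) ⟩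
  ((a + (x ∸ a)) + (b + (y ∸ b))) ∸ (a + b)  ≡⟨ cong (_∸ (a + b)) (shuffle a (x ∸ a) b (y ∸ b)) ⟩
  ((a + b) + ((x ∸ a) + (y ∸ b))) ∸ (a + b)  ≡⟨ m+n∸m≡n (a + b) _ ⟩
  (x ∸ a) + (y ∸ b)                          ∎
  where
  open ≤-Reasoning
  shuffle : ∀ a x b y → (a + x) + (b + y) ≡ (a + b) + (x + y)
  shuffle = solve-∀

-- The ring solver behind solve-∀ does not recognise ℕ's _^_, so identities with powers use +-*-Solver.
excess-step : ∀ m r δ → r ^ 2 ≤ m ^ 5 → δ ^ 2 ≤ 4 * m ^ 3 → (r + δ) ^ 2 ≤ suc m ^ 5
excess-step m r δ r² δ² = begin
  (r + δ) ^ 2                                                                         ≡⟨ square-of-sum r δ ⟩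
  r ^ 2 + 2 * (r * δ) + δ ^ 2                                                         ≤⟨ +-mono-≤ (+-mono-≤ r² (*-monoʳ-≤ 2 rδ≤)) δ² ⟩
  m ^ 5 + 2 * (2 * m ^ 4) + 4 * m ^ 3                                                 ≤⟨ m≤m+n _ _ ⟩
  m ^ 5 + 2 * (2 * m ^ 4) + 4 * m ^ 3 + (m ^ 4 + 6 * m ^ 3 + 10 * m ^ 2 + 5 * m + 1)  ≡⟨ binomial m ⟩
  suc m ^ 5                                                                           ∎
  where
  open ≤-Reasoning
  open +-*-Solver
  square-of-sum : ∀ r δ → (r + δ) ^ 2 ≡ r ^ 2 + 2 * (r * δ) + δ ^ 2
  square-of-sum = solve 2 (λ r δ → (r :+ δ) :^ 2 := r :^ 2 :+ con 2 :* (r :* δ) :+ δ :^ 2) refl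
  binomial : ∀ m → m ^ 5 + 2 * (2 * m ^ 4) + 4 * m ^ 3 + (m ^ 4 + 6 * m ^ 3 + 10 * m ^ 2 + 5 * m + 1) ≡ suc m ^ 5
  binomial = solve 1 (λ m → m :^ 5 :+ con 2 :* (con 2 :* m :^ 4) :+ con 4 :* m :^ 3
                            :+ (m :^ 4 :+ con 6 :* m :^ 3 :+ con 10 :* m :^ 2 :+ con 5 :* m :+ con 1)
                            := (con 1 :+ m) :^ 5) refl
  rδ≤ : r * δ ≤ 2 * m ^ 4
  rδ≤ = m^2≤n^2⇒m≤n (begin
    (r * δ) ^ 2          ≡⟨ solve 2 (λ r δ → (r :* δ) :^ 2 := r :^ 2 :* δ :^ 2) refl r δ ⟩
    r ^ 2 * δ ^ 2        ≤⟨ *-mono-≤ r² δ² ⟩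
    m ^ 5 * (4 * m ^ 3)  ≡⟨ solve 1 (λ m → m :^ 5 :* (con 4 :* m :^ 3) := (con 2 :* m :^ 4) :^ 2) refl m ⟩
    (2 * m ^ 4) ^ 2      ∎)

excess-few-vertices : ∀ {m c} → m ≤ 4 → c ≤ 2 ^ m → (2 * c ∸ (6 * m + 3)) ^ 2 ≤ 4 * m ^ 3
excess-few-vertices {m} m≤4 c≤ = ≤-trans (^-monoˡ-≤ 2 (∸-monoˡ-≤ (6 * m + 3) (*-monoʳ-≤ 2 c≤))) (check m≤4)
  where
  check : ∀ {m} → m ≤ 4 → (2 * 2 ^ m ∸ (6 * m + 3)) ^ 2 ≤ 4 * m ^ 3
  check {0} _ = z≤n
  check {1} _ = z≤n
  check {2} _ = z≤n
  check {3} _ = z≤n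
  check {4} _ = from-yes (25 ≤? 256)
  check {suc (suc (suc (suc (suc _))))} (s≤s (s≤s (s≤s (s≤s ()))))

excess-few-faces : ∀ {m c} → 5 ≤ m → c ≤ 8 → (2 * c ∸ (6 * m + 3)) ^ 2 ≤ 4 * m ^ 3
excess-few-faces {m} {c} 5≤m c≤8 = ≤-trans (≤-reflexive (cong (_^ 2) (m≤n⇒m∸n≡0 2c≤6m+3))) z≤n
  where
  2c≤6m+3 : 2 * c ≤ 6 * m + 3
  2c≤6m+3 = ≤-trans (*-monoʳ-≤ 2 c≤8) (≤-trans (from-yes (16 ≤? 33)) (+-monoˡ-≤ 3 (*-monoʳ-≤ 6 5≤m)))

u²≤3m³ : ∀ m u → (5 * m + u) * (5 * m + u) ≤ m * (5 * m + u) + 3 * (m * (m * m)) → u ^ 2 ≤ 3 * m ^ 3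
u²≤3m³ m u h = ≤-trans (m≤m+n (u ^ 2) W) (+-cancelʳ-≤ V (u ^ 2 + W) (3 * m ^ 3) (begin
  u ^ 2 + W + V                          ≡⟨ expand m u ⟩
  (5 * m + u) * (5 * m + u)              ≤⟨ h ⟩
  m * (5 * m + u) + 3 * (m * (m * m))    ≡⟨ collect m u ⟩
  3 * m ^ 3 + V                          ∎))
  where
  open ≤-Reasoning
  open +-*-Solver
  W = 20 * m ^ 2 + 9 * (m * u)
  V = 5 * m ^ 2 + m * u
  expand : ∀ m u → u ^ 2 + (20 * m ^ 2 + 9 * (m * u)) + (5 * m ^ 2 + m * u) ≡ (5 * m + u) * (5 * m + u)
  expand = solve 2 (λ m u → u :^ 2 :+ (con 20 :* m :^ 2 :+ con 9 :* (m :* u)) :+ (con 5 :* m :^ 2 :+ m :* u)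
                            := (con 5 :* m :+ u) :* (con 5 :* m :+ u)) refl
  collect : ∀ m u → m * (5 * m + u) + 3 * (m * (m * m)) ≡ 3 * m ^ 3 + (5 * m ^ 2 + m * u)
  collect = solve 2 (λ m u → m :* (con 5 :* m :+ u) :+ con 3 :* (m :* (m :* m))
                             := con 3 :* m :^ 3 :+ (con 5 :* m :^ 2 :+ m :* u)) refl

excess-C4-free-graph : ∀ m S t → t ≤ 2 + m + S → S * S ≤ m * S + 3 * (m * (m * m)) →
  (t ∸ (6 * m + 3)) ^ 2 ≤ 4 * m ^ 3
excess-C4-free-graph m S t t≤ S² = ≤-trans (^-monoˡ-≤ 2 excess≤u) u²≤
  where
  open ≤-Reasoning
  u = S ∸ 5 * m
  excess≤u : t ∸ (6 * m + 3) ≤ u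
  excess≤u = begin
    t ∸ (6 * m + 3)                ≤⟨ ∸-monoˡ-≤ (6 * m + 3) (begin
      t                              ≤⟨ t≤ ⟩
      2 + m + S                      ≤⟨ +-monoʳ-≤ (2 + m) (m≤n+m∸n S (5 * m)) ⟩
      2 + m + (5 * m + u)            ≤⟨ n≤1+n _ ⟩
      suc (2 + m + (5 * m + u))      ≡⟨ collect m u ⟩
      6 * m + 3 + u                  ∎) ⟩
    (6 * m + 3 + u) ∸ (6 * m + 3)  ≡⟨ m+n∸m≡n (6 * m + 3) u ⟩
    u                              ∎
    where
    collect : ∀ m u → suc (2 + m + (5 * m + u)) ≡ 6 * m + 3 + u
    collect = solve-∀
  u²≤ : u ^ 2 ≤ 4 * m ^ 3
  u²≤ with 5 * m ≤? S
  ... | no 5m≰S rewrite m≤n⇒m∸n≡0 (<⇒≤ (≰⇒> 5m≰S)) = z≤n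
  ... | yes 5m≤S = ≤-trans (u²≤3m³ m u (subst (λ S → S * S ≤ m * S + 3 * (m * (m * m))) (sym (m+[n∸m]≡n 5m≤S)) S²))
                           (*-monoˡ-≤ (m ^ 3) (from-yes (3 ≤? 4)))

-- Copies of complexes

link : ∀ {m} → Complex (suc m) → Complex m
link H = record { edge = edge H ∘ (inside ∷_) ; closed = λ s t s⊆t → closed H _ _ (s⊆s s⊆t) }

deletion : ∀ {m} → Complex (suc m) → Complex m
deletion H = record { edge = edge H ∘ (outside ∷_) ; closed = λ s t s⊆t → closed H _ _ (s⊆s s⊆t) }

image-suc : ∀ {k n} (φ : Fin k → Fin n) (e : Subset k) → image (suc ∘ φ) e ≡ outside ∷ image φ e
image-suc {zero}  φ []            = refl
image-suc {suc k} φ (inside ∷ e)  = cong (⁅ suc (φ zero) ⁆ ∪_) (image-suc (φ ∘ suc) e)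
image-suc {suc k} φ (outside ∷ e) = image-suc (φ ∘ suc) e

deletion-FFree : ∀ {m} k d (H : Complex (suc m)) → FFree k d H → FFree k d (deletion H)
deletion-FFree k d H free F F∈ (φ , φ-injective , φ-edges) =
  free F F∈ ( suc ∘ φ , φ-injective ∘ suc-injective
            , λ e e∈F → subst (λ s → edge H s ≡ true) (sym (image-suc φ e)) (φ-edges e e∈F) )

image-⊆ : ∀ {k n} (φ : Fin k → Fin n) (e : Subset k) {X : Subset n} → (∀ {i} → i ∈ e → φ i ∈ X) → image φ e ⊆ X
image-⊆ {zero}  φ []            φ[e]⊆X x∈ = contradiction x∈ ∉⊥
image-⊆ {suc k} φ (inside ∷ e)  φ[e]⊆X x∈ with x∈p∪q⁻ ⁅ φ zero ⁆ (image (φ ∘ suc) e) x∈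
... | inj₁ x∈⁅φ0⁆ = subst (_∈ _) (sym (x∈⁅y⁆⇒x≡y (φ zero) x∈⁅φ0⁆)) (φ[e]⊆X here)
... | inj₂ x∈φ[e] = image-⊆ (φ ∘ suc) e (φ[e]⊆X ∘ there) x∈φ[e]
image-⊆ {suc k} φ (outside ∷ e) φ[e]⊆X x∈ = image-⊆ (φ ∘ suc) e (φ[e]⊆X ∘ there) x∈

witness : ∀ {A : Set} (a? : Dec A) → does a? ≡ true → A
witness (yes a) _ = a

generatedBy : ∀ {k} → List (Subset k) → Complex k
generatedBy fs = record
  { edge   = λ s → does (any? (s ⊆?_) fs)
  ; closed = λ s t s⊆t t⊆f → dec-true (any? (s ⊆?_) fs) (Any.map (⊆-trans s⊆t) (witness (any? (t ⊆?_) fs) t⊆f))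
  }

ImageInEdge : ∀ {n k} → Complex n → (Fin k → Fin n) → Subset k → Set
ImageInEdge H φ f = ∃ λ X → edge H X ≡ true × (∀ {i} → i ∈ f → φ i ∈ X)

copy-of-generatedBy : ∀ {n k} (H : Complex n) (fs : List (Subset k)) {vs : Vec (Fin n) k} → Unique vs →
  All (ImageInEdge H (lookup vs)) fs → ContainsCopy H (generatedBy fs)
copy-of-generatedBy H fs {vs} unique facets↦edges =
  lookup vs , (λ {i} {j} → Unique.lookup-injective unique i j) ,
  λ e e∈ → edge-of-face (witness (any? (e ⊆?_) fs) e∈) facets↦edges
  where
  edge-of-face : ∀ {e fs} → Any.Any (e ⊆_) fs → All (ImageInEdge H (lookup vs)) fs → edge H (image (lookup vs) e) ≡ true
  edge-of-face {e} (Any.here e⊆f) ((X , X∈H , f↦X) ∷ _) = closed H _ X (image-⊆ (lookup vs) e (f↦X ∘ e⊆f)) X∈H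
  edge-of-face (Any.there e∈fs) (_ ∷ facets↦edges) = edge-of-face e∈fs facets↦edges

Unique-zero∷map-suc : ∀ {n k} {vs : Vec (Fin n) k} → Unique vs → Unique (zero ∷ Vec.map suc vs)
Unique-zero∷map-suc {vs = vs} unique = VecAll.map⁺ (VecAll.universal (λ _ → 0≢1+n) vs) ∷ Unique.map⁺ suc-injective unique

distinct-elements : ∀ {n k} (s : Subset n) → k ≤ ∣ s ∣ →
  ∃ λ (vs : Vec (Fin n) k) → Unique vs × VecAll.All (_∈ s) vs
distinct-elements {k = zero}  s             _        = [] , [] , []
distinct-elements {k = suc k} (inside ∷ s)  (s≤s k≤) with distinct-elements s k≤
... | vs , unique , vs⊆s = zero ∷ Vec.map suc vs , Unique-zero∷map-suc unique , here ∷ VecAll.map⁺ (VecAll.map there vs⊆s)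
distinct-elements {k = suc k} (outside ∷ s) k≤       with distinct-elements s k≤
... | vs , unique , vs⊆s = Vec.map suc vs , Unique.map⁺ suc-injective unique , VecAll.map⁺ (VecAll.map there vs⊆s)


σ₀₁₂ σ₀₂₃ σ₀₃₄ σ₁₄ σ₀₁₂₃ σ₄ : Subset 5
σ₀₁₂  = inside  ∷ inside  ∷ inside  ∷ outside ∷ outside ∷ []
σ₀₂₃  = inside  ∷ outside ∷ inside  ∷ inside  ∷ outside ∷ []
σ₀₃₄  = inside  ∷ outside ∷ outside ∷ inside  ∷ inside  ∷ []
σ₁₄   = outside ∷ inside  ∷ outside ∷ outside ∷ inside  ∷ []
σ₀₁₂₃ = inside  ∷ inside  ∷ inside  ∷ inside  ∷ outside ∷ []
σ₄    = outside ∷ outside ∷ outside ∷ outside ∷ inside  ∷ []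

fan : Complex 5
fan = generatedBy (σ₀₁₂ ∷ σ₀₂₃ ∷ σ₀₃₄ ∷ σ₁₄ ∷ [])

tetrahedron+vertex : Complex 5
tetrahedron+vertex = generatedBy (σ₀₁₂₃ ∷ σ₄ ∷ [])

fan∈𝓕 : InFamily 5 2 fan
fan∈𝓕 = refl

tetrahedron+vertex∈𝓕 : InFamily 5 2 tetrahedron+vertex
tetrahedron+vertex∈𝓕 = refl

-- The link of a vertex

x∈⁅x⁆∪⁅y⁆ : ∀ {n} (x y : Fin n) → x ∈ ⁅ x ⁆ ∪ ⁅ y ⁆
x∈⁅x⁆∪⁅y⁆ x y = x∈p∪q⁺ (inj₁ (x∈⁅x⁆ x))

y∈⁅x⁆∪⁅y⁆ : ∀ {n} (x y : Fin n) → y ∈ ⁅ x ⁆ ∪ ⁅ y ⁆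
y∈⁅x⁆∪⁅y⁆ x y = x∈p∪q⁺ (inj₂ (x∈⁅x⁆ y))

module _ {m} (H : Complex (suc m)) (free : FFree 5 2 H) where

  link-C4Free : C4Free (edge (link H))
  link-C4Free {p} {q} {r} {s} unique pq qr rs sp =
    free fan fan∈𝓕 (copy-of-generatedBy H _ (Unique-zero∷map-suc unique)
      ((_ , pq , 012↦) ∷ (_ , qr , 023↦) ∷ (_ , rs , 034↦) ∷ (_ , sp , 14↦) ∷ []))
    where
    φ : Fin 5 → Fin (suc m)
    φ = lookup (zero ∷ Vec.map suc (p ∷ q ∷ r ∷ s ∷ []))
    012↦ : ∀ {i} → i ∈ σ₀₁₂ → φ i ∈ inside ∷ (⁅ p ⁆ ∪ ⁅ q ⁆)
    012↦ here                 = here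
    012↦ (there here)         = there (x∈⁅x⁆∪⁅y⁆ p q)
    012↦ (there (there here)) = there (y∈⁅x⁆∪⁅y⁆ p q)
    012↦ (there (there (there (there (there ())))))
    023↦ : ∀ {i} → i ∈ σ₀₂₃ → φ i ∈ inside ∷ (⁅ q ⁆ ∪ ⁅ r ⁆)
    023↦ here                         = here
    023↦ (there (there here))         = there (x∈⁅x⁆∪⁅y⁆ q r)
    023↦ (there (there (there here))) = there (y∈⁅x⁆∪⁅y⁆ q r)
    023↦ (there (there (there (there (there ())))))
    034↦ : ∀ {i} → i ∈ σ₀₃₄ → φ i ∈ inside ∷ (⁅ r ⁆ ∪ ⁅ s ⁆)
    034↦ here                                 = here
    034↦ (there (there (there here)))         = there (x∈⁅x⁆∪⁅y⁆ r s)
    034↦ (there (there (there (there here)))) = there (y∈⁅x⁆∪⁅y⁆ r s)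
    034↦ (there (there (there (there (there ())))))
    14↦ : ∀ {i} → i ∈ σ₁₄ → φ i ∈ inside ∷ (⁅ s ⁆ ∪ ⁅ p ⁆)
    14↦ (there here)                         = there (y∈⁅x⁆∪⁅y⁆ s p)
    14↦ (there (there (there (there here)))) = there (x∈⁅x⁆∪⁅y⁆ s p)
    14↦ (there (there (there (there (there ())))))

  link-no-tetrahedron+vertex : ∀ {a b c d} {X Y : Subset m} → Unique (a ∷ b ∷ c ∷ d ∷ []) →
    edge (link H) X ≡ true → a ∈ X → b ∈ X → c ∈ X → edge (link H) Y ≡ true → ¬ d ∈ Y
  link-no-tetrahedron+vertex {a} {b} {c} {d} {X} {Y} unique X∈ a∈X b∈X c∈X Y∈ d∈Y =
    free tetrahedron+vertex tetrahedron+vertex∈𝓕 (copy-of-generatedBy H _ (Unique-zero∷map-suc unique)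
      ((_ , X∈ , 0123↦) ∷ (_ , Y∈ , 4↦) ∷ []))
    where
    φ : Fin 5 → Fin (suc m)
    φ = lookup (zero ∷ Vec.map suc (a ∷ b ∷ c ∷ d ∷ []))
    0123↦ : ∀ {i} → i ∈ σ₀₁₂₃ → φ i ∈ inside ∷ X
    0123↦ here                         = here
    0123↦ (there here)                 = there a∈X
    0123↦ (there (there here))         = there b∈X
    0123↦ (there (there (there here))) = there c∈X
    0123↦ (there (there (there (there (there ())))))
    4↦ : ∀ {i} → i ∈ σ₄ → φ i ∈ inside ∷ Y
    4↦ (there (there (there (there here)))) = there d∈Y
    4↦ (there (there (there (there (there ())))))

  link-face-size≤3 : ∀ {s} → edge (link H) s ≡ true → ∣ s ∣ ≤ 3
  link-face-size≤3 {s} s∈ with 4 ≤? ∣ s ∣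
  ... | no 4≰ = ≤-pred (≰⇒> 4≰)
  ... | yes 4≤ with distinct-elements s 4≤
  ...   | (a ∷ b ∷ c ∷ d ∷ []) , unique , (a∈ ∷ b∈ ∷ c∈ ∷ d∈ ∷ []) =
    contradiction d∈ (link-no-tetrahedron+vertex unique s∈ a∈ b∈ c∈ s∈)

  link-⊆-large-face : ∀ {s t} → edge (link H) s ≡ true → 3 ≤ ∣ s ∣ → edge (link H) t ≡ true → t ⊆ s
  link-⊆-large-face {s} s∈ 3≤ t∈ {y} y∈t with y ∈? s | distinct-elements s 3≤
  ... | yes y∈s | _ = y∈s
  ... | no y∉s  | (a ∷ b ∷ c ∷ []) , ((a≢b ∷ a≢c ∷ []) ∷ (b≢c ∷ []) ∷ [] ∷ []) , (a∈ ∷ b∈ ∷ c∈ ∷ []) =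
    contradiction y∈t (link-no-tetrahedron+vertex unique s∈ a∈ b∈ c∈ t∈)
    where
    ≢y : ∀ {x} → x ∈ s → x ≢ y
    ≢y x∈ x≡y = y∉s (subst (_∈ s) x≡y x∈)
    unique : Unique (a ∷ b ∷ c ∷ y ∷ [])
    unique = (a≢b ∷ a≢c ∷ ≢y a∈ ∷ []) ∷ (b≢c ∷ ≢y b∈ ∷ []) ∷ (≢y c∈ ∷ []) ∷ [] ∷ []

  link-graph-or-small : SizesBelow 3 (edge (link H)) ⊎ count (edge (link H)) ≤ 8
  link-graph-or-small with anySubset? (λ s → (edge (link H) s ≟ᵇ true) ×-dec (3 ≤? ∣ s ∣))
  ... | yes (s , s∈ , 3≤) =
    inj₂ (≤-trans (count≤2^∣X∣ _ s (λ t t∈ → link-⊆-large-face s∈ 3≤ t∈)) (^-monoʳ-≤ 2 (link-face-size≤3 s∈)))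
  ... | no no-large = inj₁ (λ s s∈ → ≰⇒> (λ 3≤ → no-large (s , s∈ , 3≤)))

  link-excess : (2 * count (edge (link H)) ∸ (6 * m + 3)) ^ 2 ≤ 4 * m ^ 3
  link-excess with m ≤? 4 | link-graph-or-small
  ... | yes m≤4 | _          = excess-few-vertices m≤4 (count≤2^n (edge (link H)))
  ... | no m≰4  | inj₂ ≤8    = excess-few-faces (≰⇒> m≰4) ≤8
  ... | no _    | inj₁ graph =
    excess-C4-free-graph m _ _ (count-sizes<3 (edge (link H)) graph) (degreeSum²≤ (edge (link H)) link-C4Free)


excess-one-vertex : (H : Complex 1) → (2 * count (edge H) ∸ 3 * 1 ^ 2) ^ 2 ≤ 1 ^ 5
excess-one-vertex H with edge H (inside ∷ []) | edge H (outside ∷ [])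
... | true  | true  = ≤-refl
... | true  | false = z≤n
... | false | true  = z≤n
... | false | false = z≤n

excess-bound : ∀ n (H : Complex (suc n)) → FFree 5 2 H → (2 * count (edge H) ∸ 3 * suc n ^ 2) ^ 2 ≤ suc n ^ 5
excess-bound zero    H _    = excess-one-vertex H
excess-bound (suc m) H free = begin
  (2 * (cL + cD) ∸ 3 * suc (suc m) ^ 2) ^ 2  ≤⟨ ^-monoˡ-≤ 2 split ⟩
  (r + δ) ^ 2                                ≤⟨ excess-step (suc m) r δ r² (link-excess H free) ⟩
  suc (suc m) ^ 5                            ∎
  where
  open ≤-Reasoning
  open +-*-Solver
  cL = count (edge (link H))
  cD = count (edge (deletion H))
  r = 2 * cD ∸ 3 * suc m ^ 2
  δ = 2 * cL ∸ (6 * suc m + 3)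
  r² : r ^ 2 ≤ suc m ^ 5
  r² = excess-bound m (deletion H) (deletion-FFree 5 2 H free)
  split : 2 * (cL + cD) ∸ 3 * suc (suc m) ^ 2 ≤ r + δ
  split = begin
    2 * (cL + cD) ∸ 3 * suc (suc m) ^ 2                    ≡⟨ cong₂ _∸_ (*-distribˡ-+ 2 cL cD)
                                                                (solve 1 (λ m → con 3 :* (con 2 :+ m) :^ 2
                                                                                := con 6 :* (con 1 :+ m) :+ con 3 :+ con 3 :* (con 1 :+ m) :^ 2) refl m) ⟩
    (2 * cL + 2 * cD) ∸ ((6 * suc m + 3) + 3 * suc m ^ 2)  ≤⟨ [x+y]∸[a+b]≤[x∸a]+[y∸b] (2 * cL) (2 * cD) (6 * suc m + 3) (3 * suc m ^ 2) ⟩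
    δ + r                                                  ≡⟨ +-comm δ r ⟩
    r + δ                                                  ∎

-- The hypothesis 5 ≤ n is only used to exclude n = 0; the bound holds for every n ≥ 1.
proposition6p4 : ∀ (n : ℕ) → 5 ≤ n → ∀ (H : Complex n) → FFree 5 2 H →
    ((2 * numEdges H) ∸ (3 * n ^ 2)) ^ 2 ≤ n ^ 5
proposition6p4 (suc n) _ H free rewrite numEdges≡count H = excess-bound n H free
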